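{- Let $H$ be a graph with chromatic index $c$ and let $\{X_i,Y_i,Z_i: i \in \mathbb{Z}_{c}\}$ be an $(x,w)$-partition of $H$ for some nonnegative integers $x,w$; let $y=\lceil 3x-\frac32 w\rceil$ and, for $i\in\mathbb{Z}_c$, let $Y_i'$ be the set of edges of $Y_i$ adjacent to exactly two edges of $X_{i-1}$. Then there are, for all $i\in \mathbb{Z}_{c}$, orderings $\ell_{Y_i}$ and $\ell_{Z_i}$ of (the subgraphs formed by the edges of) $Y_i$ and $Z_i$ such that, for all $i\in\mathbb{Z}_c$, $\mathrm{ms}(\ell_{Y_i} \vee \ell_{Z_{i+1}}) \geq y-1$ and, in $\ell_{Y_i}$, the edges in $Y_i'$ are the last to occur.
   Context: All graphs are finite and simple; two edges are adjacent if they share a vertex. A matching decomposition of $H$ is a set of edge-disjoint matchings partitioning $E(H)$; it is equitable if any two of its matchings differ in size by at most one. Given $X_i\subseteq E(H_i)$ for a matching decomposition $\{H_0,\dots,H_{c-1}\}$, a vertex $v$ is $i$-covered for $\{X_0,\dots,X_{c-1}\}$ if $v$ is incident with an edge of $X_i$ and either $v$ is incident with an edge of $X_{i+1}$ or no edge of $H_{i+1}$ is incident with $v$ (indices mod $c$). An $(x,w)$-partition of $H$ is a partition $\{X_i,Y_i,Z_i:i\in\mathbb{Z}_c\}$ of $E(H)$ (with specified roles) such that: (P1) $w\leq\frac32 x$ and $x+2y\leq\lfloor|E(H)|/c\rfloor$ with $y=\lceil 3x-\frac32 w\rceil$; (P2) $\{H_i\}$ is an equitable matching decomposition of $H$, where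 $H_i$ has edge set $X_i\cup Y_i\cup Z_i$; (P3) $|X_i|=x$, $|Y_i|=y$ for all $i$; (P4) no edge of $X_i$ is adjacent to an edge of $Z_{i+1}$; (P5) $|Y_i'|\leq y/3$ and each edge of $Y_i'$ is adjacent to at most one edge of $Z_{i+1}$; (P6) for all $i$, at least $w$ vertices are $i$-covered for $\{X_0,\dots,X_{c-1}\}$. An ordering of a graph with $m$ edges is a bijection $\ell:E\to\mathbb{Z}_m$; $d_\ell(e,e')$ is the smallest positive $d$ with $\ell(e)+d=\ell(e')$ in $\mathbb{Z}_m$; $\mathrm{ms}(\ell)$ is the largest $s\in\{1,\dots,m\}$ with $d_\ell(e,e')\geq s$ for every ordered pair of adjacent edges with $\ell(e)<\ell(e')$. For edge-disjoint graphs with orderings $\ell_0,\ell_1$, $\ell_0\vee\ell_1$ assigns $\ell_0(e)$ to edges of the first graph and $|E(G_0)|+\ell_1(e)$ to edges of the second. -}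

module Defs where

open import Data.Nat using (ℕ; zero; suc; _+_; _*_; _∸_; _≤_; _<_; _≡ᵇ_)
open import Data.Nat.DivMod using (_/_; _%_; m%n<n)
open import Data.Fin using (Fin; toℕ; fromℕ<) renaming (zero to fzero; suc to fsuc)
open import Data.Fin.Properties using (_≟_)
open import Data.Bool using (Bool; true; false; _∧_; _∨_; not; if_then_else_)
open import Data.Product using (Σ; _×_; _,_; proj₁; proj₂)
open import Data.Sum using (_⊎_)
open import Data.List using (List; length; lookup; _++_)
open import Data.List.Membership.Propositional using (_∈_)
open import Data.List.Relation.Unary.Unique.Propositional using (Unique)
open import Relation.Nullary using (¬_; does)
open import Relation.Binary.PropositionalEquality using (_≡_; _≢_)

record Graph : Set where
  field
    n        : ℕ
    m        : ℕ
    ends     : Fin m → Fin n × Fin n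
    loopless : ∀ e → proj₁ (ends e) ≢ proj₂ (ends e)
    simple   : ∀ e f →
      ((proj₁ (ends e) ≡ proj₁ (ends f)) × (proj₂ (ends e) ≡ proj₂ (ends f)))
      ⊎ ((proj₁ (ends e) ≡ proj₂ (ends f)) × (proj₂ (ends e) ≡ proj₁ (ends f)))
      → e ≡ f

_==_ : ∀ {k} → Fin k → Fin k → Bool
a == b = does (a ≟ b)

count : ∀ {k} → (Fin k → Bool) → ℕ
count {zero}  p = 0
count {suc k} p = (if p fzero then 1 else 0) + count (λ i → p (fsuc i))

anyF : ∀ {k} → (Fin k → Bool) → Bool
anyF {zero}  p = false
anyF {suc k} p = p fzero ∨ anyF (λ i → p (fsuc i))

module _ (G : Graph) where
  open Graph G

  incident : Fin n → Fin m → Bool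
  incident v e = (v == proj₁ (ends e)) ∨ (v == proj₂ (ends e))

  adjB : Fin m → Fin m → Bool
  adjB e f = not (e == f) ∧ anyF (λ v → incident v e ∧ incident v f)

  Adjacent : Fin m → Fin m → Set
  Adjacent e f = adjB e f ≡ true

  ProperEdgeColouring : ℕ → Set
  ProperEdgeColouring k =
    Σ (Fin m → Fin k) λ col → ∀ e f → Adjacent e f → col e ≢ col f

  ChromaticIndex : ℕ → Set
  ChromaticIndex c = ProperEdgeColouring c × (∀ k → ProperEdgeColouring k → c ≤ k)

next : ∀ {c} → Fin c → Fin c
next {suc k} i = fromℕ< (m%n<n (suc (toℕ i)) (suc k))

prev : ∀ {c} → Fin c → Fin c
prev {suc k} i = fromℕ< (m%n<n (toℕ i + k) (suc k))

-- a mod M (with a mod 0 = a; only used with M > 0)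
_mod_ : ℕ → ℕ → ℕ
a mod zero  = a
a mod suc k = a % suc k

-- ⌊ a / c ⌋ (with value 0 for c = 0; c = 0 only for the edgeless graph)
floorDiv : ℕ → ℕ → ℕ
floorDiv a zero    = 0
floorDiv a (suc k) = a / suc k

-- y = ⌈ 3x − (3/2) w ⌉ = ⌈ (6x − 3w) / 2 ⌉, valid when 2w ≤ 3x
yOf : ℕ → ℕ → ℕ
yOf x w = (6 * x ∸ 3 * w + 1) / 2

data Role : Set where
  RX RY RZ : Role

_==R_ : Role → Role → Bool
RX ==R RX = true
RY ==R RY = true
RZ ==R RZ = true
_  ==R _  = false

-- A partition {X_i, Y_i, Z_i : i ∈ ℤ_c} of E(H) is given by two labelling
-- functions: cls e = the index i of the part containing e, rl e = its role
-- (X, Y or Z).  Thus e ∈ X_i iff cls e ≡ i and rl e ≡ RX, etc., and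
-- H_i = X_i ∪ Y_i ∪ Z_i = { e | cls e ≡ i }.

module Partition (G : Graph) {c : ℕ} (cls : Fin (Graph.m G) → Fin c)
                 (rl : Fin (Graph.m G) → Role) where
  open Graph G

  inH : Fin c → Fin m → Bool
  inH i e = cls e == i

  inX inY inZ : Fin c → Fin m → Bool
  inX i e = inH i e ∧ (rl e ==R RX)
  inY i e = inH i e ∧ (rl e ==R RY)
  inZ i e = inH i e ∧ (rl e ==R RZ)

  inY' : Fin c → Fin m → Bool
  inY' i e = inY i e ∧ (count (λ f → inX (prev i) f ∧ adjB G e f) ≡ᵇ 2)

  touches : (Fin m → Bool) → Fin n → Bool
  touches S v = anyF (λ f → S f ∧ incident G v f)

  covered : Fin c → Fin n → Bool
  covered i v = touches (inX i) v ∧ (touches (inX (next i)) v ∨ not (touches (inH (next i)) v))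

  record IsXWPartition (x w : ℕ) : Set where
    field
      P1a : 2 * w ≤ 3 * x
      P1b : x + 2 * yOf x w ≤ floorDiv m c
      P2-matching : ∀ e f → cls e ≡ cls f → ¬ Adjacent G e f
      P2-equitable : ∀ i j → count (inH i) ≤ count (inH j) + 1
      P3-X : ∀ i → count (inX i) ≡ x
      P3-Y : ∀ i → count (inY i) ≡ yOf x w
      P4 : ∀ i e f → inX i e ≡ true → inZ (next i) f ≡ true → ¬ Adjacent G e f
      P5-size : ∀ i → 3 * count (inY' i) ≤ yOf x w
      P5-adj : ∀ i e → inY' i e ≡ true →
               count (λ f → inZ (next i) f ∧ adjB G e f) ≤ 1
      P6 : ∀ i → w ≤ count (covered i)

-- An ordering ℓ : S → ℤ_|S| of an edge set S is represented by
-- the list of the edges of S listed in the order ℓ (the edge at position p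
-- has ℓ-value p).  The join ℓ₀ ∨ ℓ₁ is then list concatenation.

module Orderings (G : Graph) where
  open Graph G

  IsOrdering : (Fin m → Bool) → List (Fin m) → Set
  IsOrdering S L = Unique L × (∀ e → e ∈ L → S e ≡ true) × (∀ e → S e ≡ true → e ∈ L)

  -- every ordered pair (e,e') of adjacent edges with ℓ(e) < ℓ(e') has
  -- d_ℓ(e,e') ≥ s, where d_ℓ(e,e') is the least positive d with
  -- ℓ(e) + d = ℓ(e') in ℤ_M (M = number of edges)
  SpreadAtLeast : List (Fin m) → ℕ → Set
  SpreadAtLeast L s = ∀ (p q : Fin (length L)) → toℕ p < toℕ q →
    Adjacent G (lookup L p) (lookup L q) →
    ∀ d → 1 ≤ d → d < s → ((toℕ p + d) mod length L) ≢ toℕ q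

  -- ms(ℓ) ≥ t : the largest s ∈ {1,…,M} with SpreadAtLeast is ≥ t
  MsAtLeast : List (Fin m) → ℕ → Set
  MsAtLeast L t = Σ ℕ λ s → (1 ≤ s) × (s ≤ length L) × (t ≤ s) × SpreadAtLeast L s

  LastOccur : (Fin m → Bool) → List (Fin m) → Set
  LastOccur S' L = ∀ (p q : Fin (length L)) →
    S' (lookup L p) ≡ true → S' (lookup L q) ≡ false → toℕ q < toℕ p

-- Fix i and let Y = Y_i, Z = Z_{i+1}, a = |Y| and b = |Z|; by (P1) and equitability a ≤ b.
-- Both are matchings, so every edge of Y is adjacent to at most two edges of Z and vice
-- versa, and by (P5) an edge of Y' is adjacent to at most one edge of Z.  Build the two
-- orderings from the back: place the edges of Y one at a time, each time prepending its
-- not yet placed neighbours in Z to the placed part of Z, while keeping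
-- |placed Z| + a ≤ |placed Y| + b + 1.  An edge with at most one new neighbour can always
-- be placed; if every remaining edge has two, double counting the adjacencies between
-- unplaced edges gives |placed Z| + a ≤ |placed Y| + b, so any of them can be placed.
-- This invariant puts every edge of Z at least a − 1 positions after each of its
-- neighbours in ℓ_Y ∨ ℓ_Z.  Placing the edges of Y' first makes them last in ℓ_Y, and the
-- edges of Z left over at the end have no neighbour in Y, so they go in front.

module Submission where

open import Defs
open import Data.Nat using (ℕ; zero; suc; _+_; _*_; _∸_; _≤_; _<_; z≤n; s≤s; NonZero)
open import Data.Nat.Properties hiding (_≟_)
open import Algebra.Properties.CommutativeMonoid.Sum +-0-commutativeMonoid using (sum; ∑-comm; sum-cong-≗)
open import Algebra.Properties.CommutativeSemigroup +-commutativeSemigroup using (x∙yz≈y∙xz)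
open import Data.Nat.DivMod using (_/_; _%_; m%n<n; m%n%n≡m%n; %-distribˡ-+; [m+n]%n≡m%n; m<n⇒m%n≡m; m/n≡0⇒m<n; m<n*o⇒m/o<n; m≥n⇒m/n>0)
open import Data.Fin using (Fin; toℕ) renaming (zero to fzero; suc to fsuc)
open import Data.Fin.Properties using (_≟_; any?; toℕ-injective; toℕ-fromℕ<; toℕ<n) renaming (suc-injective to fsuc-injective)
open import Data.Bool using (Bool; true; false; _∧_; _∨_; not; if_then_else_)
open import Data.Bool.Properties using (∧-zeroʳ; ∧-conicalˡ; ∧-conicalʳ; not-injective) renaming (_≟_ to _≟ᵇ_)
open import Data.Product using (∃; Σ; _×_; _,_; proj₁; proj₂)
open import Data.Sum using (_⊎_; inj₁; inj₂; map₁)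
open import Data.Empty using (⊥-elim)
open import Data.List using (List; []; _∷_; [_]; length; lookup; _++_; filter; allFin)
open import Data.List.Properties using (length-++; ++-assoc; ++-identityʳ)
open import Data.List.Membership.Propositional using (_∈_; _∉_)
open import Data.List.Membership.Propositional.Properties using (∈-filter⁺; ∈-filter⁻; ∈-allFin; ∈-++⁺ˡ; ∈-++⁺ʳ; ∈-++⁻)
import Data.List.Membership.DecPropositional as DecMembership
open import Data.List.Relation.Unary.Any using (here; there)
open import Data.List.Relation.Unary.All.Properties using (All¬⇒¬Any; ¬Any⇒All¬)
open import Data.List.Relation.Unary.AllPairs using ([]; _∷_)
open import Data.List.Relation.Unary.Unique.Propositional using (Unique)
open import Data.List.Relation.Unary.Unique.Propositional.Properties using (filter⁺; allFin⁺; ++⁺)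
open import Function using (_∘_; _∘′_; mk⇔)
open import Relation.Nullary using (Dec; yes; no; does; ¬_)
open import Relation.Nullary.Decidable using (dec-true; dec-false; does-⇔; _×-dec_)
open import Relation.Binary.PropositionalEquality using (_≡_; _≢_; refl; sym; trans; cong; cong₂; subst; module ≡-Reasoning)

true≢false : ∀ {b} → b ≡ true → b ≢ false
true≢false refl ()

∨-true⁻ : ∀ {a b} → a ∨ b ≡ true → a ≡ true ⊎ b ≡ true
∨-true⁻ {true}  _ = inj₁ refl
∨-true⁻ {false} h = inj₂ h

∨-true : ∀ {a b} → a ≡ true ⊎ b ≡ true → a ∨ b ≡ true
∨-true {true}  _         = refl
∨-true {false} (inj₂ b) = b

∧-true : ∀ {a b} → a ≡ true → b ≡ true → a ∧ b ≡ true
∧-true refl b = b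

does-true⁻ : ∀ {A : Set} (a? : Dec A) → does a? ≡ true → A
does-true⁻ (yes a) _ = a

==-true⁻ : ∀ {k} {i j : Fin k} → (i == j) ≡ true → i ≡ j
==-true⁻ {i = i} {j} = does-true⁻ (i ≟ j)

==-refl : ∀ {k} (i : Fin k) → (i == i) ≡ true
==-refl i = dec-true (i ≟ i) refl

anyF-witness : ∀ {k} (p : Fin k → Bool) → anyF p ≡ true → ∃ λ i → p i ≡ true
anyF-witness {suc k} p h with ∨-true⁻ {p fzero} h
... | inj₁ p0 = fzero , p0
... | inj₂ ps with anyF-witness (p ∘ fsuc) ps
...   | i , pi = fsuc i , pi

anyF-intro : ∀ {k} (p : Fin k → Bool) i → p i ≡ true → anyF p ≡ true
anyF-intro p fzero pi rewrite pi = refl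
anyF-intro {suc k} p (fsuc i) pi with p fzero
... | true  = refl
... | false = anyF-intro (p ∘ fsuc) i pi

count-cong : ∀ {k} {p q : Fin k → Bool} → (∀ i → p i ≡ q i) → count p ≡ count q
count-cong {zero}  _ = refl
count-cong {suc k} h = cong₂ _+_ (cong (λ b → if b then 1 else 0) (h fzero)) (count-cong (h ∘ fsuc))

count-mono : ∀ {k} {p q : Fin k → Bool} → (∀ i → p i ≡ true → q i ≡ true) → count p ≤ count q
count-mono {zero} _ = z≤n
count-mono {suc k} {p} {q} h with p fzero in p0 | q fzero in q0
... | true  | true  = s≤s (count-mono (h ∘ fsuc))
... | true  | false = ⊥-elim (true≢false (h fzero p0) q0)
... | false | true  = m≤n⇒m≤1+n (count-mono (h ∘ fsuc))
... | false | false = count-mono (h ∘ fsuc)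

count-none : ∀ {k} {p : Fin k → Bool} → (∀ i → p i ≡ false) → count p ≡ 0
count-none {zero}  _ = refl
count-none {suc k} h rewrite h fzero = count-none (h ∘ fsuc)

count-pos : ∀ {k} {p : Fin k → Bool} i → p i ≡ true → 0 < count p
count-pos {p = p} fzero pi rewrite pi = s≤s z≤n
count-pos {suc k} {p} (fsuc i) pi with p fzero
... | true  = s≤s z≤n
... | false = count-pos i pi

count-witness : ∀ {k} (p : Fin k → Bool) → 0 < count p → ∃ λ i → p i ≡ true
count-witness {suc k} p pos with p fzero in p0
... | true  = fzero , p0
... | false with count-witness (p ∘ fsuc) pos
...   | i , pi = fsuc i , pi

count-remove : ∀ {k} {p q : Fin k → Bool} r → p r ≡ true → q r ≡ false →
               (∀ i → i ≢ r → p i ≡ q i) → count p ≡ suc (count q)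
count-remove fzero pr qr h rewrite pr | qr = cong suc (count-cong λ i → h (fsuc i) λ ())
count-remove {suc k} {p} {q} (fsuc r) pr qr h
  rewrite h fzero (λ ()) | count-remove r pr qr (λ i i≢r → h (fsuc i) (i≢r ∘ fsuc-injective))
  with q fzero
... | true  = refl
... | false = refl

count-atMostOne : ∀ {k} {p : Fin k → Bool} → (∀ i j → p i ≡ true → p j ≡ true → i ≡ j) → count p ≤ 1
count-atMostOne {zero} _ = z≤n
count-atMostOne {suc k} {p} h with p fzero in p0
... | true  = ≤-reflexive (cong suc (count-none tail-false))
  where
  tail-false : ∀ i → p (fsuc i) ≡ false
  tail-false i with p (fsuc i) in pi
  ... | true  with () ← h fzero (fsuc i) p0 pi
  ... | false = refl
... | false = count-atMostOne λ i j pi pj → fsuc-injective (h (fsuc i) (fsuc j) pi pj)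

count-∨ : ∀ {k} (p q : Fin k → Bool) → count (λ i → p i ∨ q i) ≤ count p + count q
count-∨ {zero} _ _ = z≤n
count-∨ {suc k} p q with p fzero | q fzero | count-∨ (p ∘ fsuc) (q ∘ fsuc)
... | true  | true  | ih = s≤s (≤-trans ih (+-monoʳ-≤ _ (n≤1+n _)))
... | true  | false | ih = s≤s ih
... | false | true  | ih = ≤-trans (s≤s ih) (≤-reflexive (sym (+-suc _ _)))
... | false | false | ih = ih

count-split : ∀ {k} (p g : Fin k → Bool) →
              count p ≡ count (λ i → p i ∧ g i) + count (λ i → p i ∧ not (g i))
count-split {zero} _ _ = refl
count-split {suc k} p g with p fzero | g fzero | count-split (p ∘ fsuc) (g ∘ fsuc)
... | true  | true  | ih = cong suc ih
... | true  | false | ih = trans (cong suc ih) (sym (+-suc _ _))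
... | false | true  | ih = ih
... | false | false | ih = ih

count-singleton : ∀ {k} (i : Fin k) → count (i ==_) ≡ 1
count-singleton {k} i = trans
  (count-remove {q = λ _ → false} i (==-refl i) refl (λ j j≢i → dec-false (i ≟ j) (j≢i ∘ sym)))
  (cong suc (count-none {k} λ _ → refl))

indicator : ∀ {k} → ℕ → (Fin k → Bool) → Fin k → ℕ
indicator d p i = if p i then d else 0

sum-indicator : ∀ {k} d (p : Fin k → Bool) → sum (indicator d p) ≡ d * count p
sum-indicator {zero}  d p = sym (*-zeroʳ d)
sum-indicator {suc k} d p with p fzero
... | true  = trans (cong (d +_) (sum-indicator d (p ∘ fsuc))) (sym (*-suc d _))
... | false = sum-indicator d (p ∘ fsuc)

count≡sum : ∀ {k} (p : Fin k → Bool) → count p ≡ sum (indicator 1 p)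
count≡sum {zero}  p = refl
count≡sum {suc k} p = cong (indicator 1 p fzero +_) (count≡sum (p ∘ fsuc))

sum-mono : ∀ {k} {f g : Fin k → ℕ} → (∀ i → f i ≤ g i) → sum f ≤ sum g
sum-mono {zero}  _ = z≤n
sum-mono {suc k} h = +-mono-≤ (h fzero) (sum-mono (h ∘ fsuc))

sum-const : ∀ k → sum {k} (λ _ → 1) ≡ k
sum-const zero    = refl
sum-const (suc k) = cong suc (sum-const k)

sum-≤-const : ∀ {k} {f : Fin k → ℕ} {B} → (∀ i → f i ≤ B) → sum f ≤ k * B
sum-≤-const {zero}  _ = z≤n
sum-≤-const {suc k} h = +-mono-≤ (h fzero) (sum-≤-const (h ∘ fsuc))

sum-<-const : ∀ {k} (f : Fin (suc k) → ℕ) {B} j → (∀ i → f i ≤ B) → f j < B → sum f < suc k * B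
sum-<-const f fzero    f≤B fj<B = +-mono-<-≤ fj<B (sum-≤-const (f≤B ∘ fsuc))
sum-<-const {suc k} f (fsuc j) f≤B fj<B = +-mono-≤-< (f≤B fzero) (sum-<-const (f ∘ fsuc) j (f≤B ∘ fsuc) fj<B)

sum-fibres : ∀ {k c} (f : Fin k → Fin c) → sum (λ j → count (λ e → f e == j)) ≡ k
sum-fibres {k} f = begin
  sum (λ j → count (λ e → f e == j))                ≡⟨ sum-cong-≗ (λ j → count≡sum (λ e → f e == j)) ⟩
  sum (λ j → sum (λ e → indicator 1 (f e ==_) j))  ≡⟨ ∑-comm (λ j e → indicator 1 (f e ==_) j) ⟩
  sum (λ e → sum (indicator 1 (f e ==_)))          ≡⟨ sum-cong-≗ (λ e → trans (sym (count≡sum (f e ==_))) (count-singleton (f e))) ⟩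
  sum {k} (λ _ → 1)                                 ≡⟨ sum-const k ⟩
  k                                                 ∎
  where open ≡-Reasoning

double-count : ∀ {k l} d (R : Fin k → Bool) (F : Fin l → Bool) (E : Fin k → Fin l → Bool) →
               (∀ r → R r ≡ true → d ≤ count (E r)) →
               (∀ z → F z ≡ true → count (λ r → E r z) ≤ d) →
               (∀ r z → E r z ≡ true → F z ≡ true) →
               d * count R ≤ d * count F
double-count d R F E out-degree in-degree E⊆F = begin
  d * count R                                ≡⟨ sum-indicator d R ⟨
  sum (indicator d R)                        ≤⟨ sum-mono from-R ⟩
  sum (λ r → count (E r))                    ≡⟨ sum-cong-≗ (count≡sum ∘ E) ⟩
  sum (λ r → sum (λ z → indicator 1 (E r) z)) ≡⟨ ∑-comm (λ r z → indicator 1 (E r) z) ⟩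
  sum (λ z → sum (λ r → indicator 1 (E r) z)) ≡⟨ sum-cong-≗ (λ z → count≡sum (λ r → E r z)) ⟨
  sum (λ z → count (λ r → E r z))            ≤⟨ sum-mono into-F ⟩
  sum (indicator d F)                        ≡⟨ sum-indicator d F ⟩
  d * count F                                ∎
  where
  open ≤-Reasoning
  from-R : ∀ r → indicator d R r ≤ count (E r)
  from-R r with R r in Rr
  ... | true  = out-degree r Rr
  ... | false = z≤n
  into-F : ∀ z → count (λ r → E r z) ≤ indicator d F z
  into-F z with F z in Fz
  ... | true  = in-degree z Fz
  ... | false = ≤-reflexive (count-none λ r → not-into r)
    where
    not-into : ∀ r → E r z ≡ false
    not-into r with E r z in Erz
    ... | true  = ⊥-elim (true≢false (E⊆F r z Erz) Fz)
    ... | false = refl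

equitable-floor : ∀ {c} (f : Fin (suc c) → ℕ) → (∀ i j → f i ≤ f j + 1) → ∀ j → sum f / suc c ≤ f j
equitable-floor {c} f equitable j = ≤-pred (m<n*o⇒m/o<n (subst (sum f <_) (*-comm (suc c) (suc (f j)))
  (sum-<-const f j (λ i → subst (f i ≤_) (+-comm (f j) 1) (equitable i j)) ≤-refl)))

floorDiv≤part : ∀ {k c} (f : Fin k → Fin c) → (∀ i j → count (λ e → f e == i) ≤ count (λ e → f e == j) + 1) →
                ∀ j → floorDiv k c ≤ count (λ e → f e == j)
floorDiv≤part {c = suc c} f equitable j =
  subst (λ n → n / suc c ≤ count (λ e → f e == j)) (sum-fibres f) (equitable-floor (λ j → count (λ e → f e == j)) equitable j)

floorDiv-pos : ∀ {k c} → Fin c → c ≤ k → 0 < floorDiv k c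
floorDiv-pos {c = suc c} _ c≤k = m≥n⇒m/n>0 c≤k

_∈?_ : ∀ {k} (x : Fin k) L → Dec (x ∈ L)
x ∈? L = DecMembership._∈?_ _≟_ x L

_∈ᵇ_ : ∀ {k} → Fin k → List (Fin k) → Bool
x ∈ᵇ L = does (x ∈? L)

∈ᵇ-true : ∀ {k} {x : Fin k} {L} → x ∈ L → (x ∈ᵇ L) ≡ true
∈ᵇ-true {x = x} {L} = dec-true (x ∈? L)

∈ᵇ-true⁻ : ∀ {k} {x : Fin k} {L} → (x ∈ᵇ L) ≡ true → x ∈ L
∈ᵇ-true⁻ {x = x} {L} = does-true⁻ (x ∈? L)

∈ᵇ-false : ∀ {k} {x : Fin k} {L} → x ∉ L → (x ∈ᵇ L) ≡ false
∈ᵇ-false {x = x} {L} = dec-false (x ∈? L)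

∈ᵇ-false⁻ : ∀ {k} {x : Fin k} {L} → (x ∈ᵇ L) ≡ false → x ∉ L
∈ᵇ-false⁻ h x∈L = true≢false (∈ᵇ-true x∈L) h

∈ᵇ-∷-≢ : ∀ {k} {x y : Fin k} {L} → x ≢ y → (x ∈ᵇ (y ∷ L)) ≡ (x ∈ᵇ L)
∈ᵇ-∷-≢ {x = x} {y} {L} x≢y = does-⇔ (mk⇔ (λ { (here x≡y) → ⊥-elim (x≢y x≡y) ; (there x∈L) → x∈L }) there) (x ∈? (y ∷ L)) (x ∈? L)

count-∈ᵇ : ∀ {k} {L : List (Fin k)} → Unique L → count (_∈ᵇ L) ≡ length L
count-∈ᵇ {k} {[]} _ = count-none {k} λ _ → refl
count-∈ᵇ {L = y ∷ L} (y∉L ∷ unique) =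
  trans (count-remove y (∈ᵇ-true {L = y ∷ L} (here refl)) (∈ᵇ-false {L = L} (All¬⇒¬Any y∉L))
                      (λ x → ∈ᵇ-∷-≢ {L = L}))
        (cong suc (count-∈ᵇ unique))

_∖_ : ∀ {k} → (Fin k → Bool) → List (Fin k) → Fin k → Bool
(p ∖ L) x = p x ∧ not (x ∈ᵇ L)

∖-true⁻ : ∀ {k} (p : Fin k → Bool) L {x} → (p ∖ L) x ≡ true → p x ≡ true × x ∉ L
∖-true⁻ p L {x} h = ∧-conicalˡ (p x) _ h , ∈ᵇ-false⁻ {L = L} (not-injective (∧-conicalʳ (p x) _ h))

∖-true : ∀ {k} {p : Fin k → Bool} {L x} → p x ≡ true → x ∉ L → (p ∖ L) x ≡ true
∖-true {L = L} px x∉L = ∧-true px (cong not (∈ᵇ-false {L = L} x∉L))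

count-∖-∷ : ∀ {k} (p : Fin k → Bool) L {x} → (p ∖ L) x ≡ true → count (p ∖ L) ≡ suc (count (p ∖ (x ∷ L)))
count-∖-∷ p L {x} h = count-remove x h x-removed λ i i≢x → cong (λ b → p i ∧ not b) (sym (∈ᵇ-∷-≢ {L = L} i≢x))
  where
  x-removed : (p ∖ (x ∷ L)) x ≡ false
  x-removed rewrite ∈ᵇ-true {x = x} {x ∷ L} (here refl) = ∧-zeroʳ (p x)

count-outside : ∀ {k} (p : Fin k → Bool) {L} → Unique L → (∀ x → x ∈ L → p x ≡ true) →
                count p ≡ length L + count (p ∖ L)
count-outside p {L} unique L⊆p = trans (count-split p (_∈ᵇ L))
  (cong (_+ count (p ∖ L)) (trans (count-cong inside) (count-∈ᵇ unique)))
  where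
  inside : ∀ x → (p x ∧ (x ∈ᵇ L)) ≡ (x ∈ᵇ L)
  inside x with x ∈ᵇ L in x∈ᵇL
  ... | true  rewrite L⊆p x (∈ᵇ-true⁻ x∈ᵇL) = refl
  ... | false = ∧-zeroʳ (p x)

Enumerates : ∀ {k} → (Fin k → Bool) → List (Fin k) → Set
Enumerates S L = Unique L × (∀ e → e ∈ L → S e ≡ true) × (∀ e → S e ≡ true → e ∈ L)

length-enumerates : ∀ {k} {p : Fin k → Bool} {L} → Enumerates p L → length L ≡ count p
length-enumerates {p = p} {L} (unique , L⊆p , p⊆L) = trans (sym (count-∈ᵇ unique)) (count-cong same)
  where
  same : ∀ x → (x ∈ᵇ L) ≡ p x
  same x with p x in px
  ... | true  = ∈ᵇ-true (p⊆L x px)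
  ... | false = ∈ᵇ-false λ x∈L → true≢false (L⊆p x x∈L) px

elems : ∀ {k} → (Fin k → Bool) → List (Fin k)
elems {k} p = filter (λ i → p i ≟ᵇ true) (allFin k)

elems-enumerates : ∀ {k} (p : Fin k → Bool) → Enumerates p (elems p)
elems-enumerates {k} p =
  filter⁺ p? (allFin⁺ k) , (λ i → proj₂ ∘ ∈-filter⁻ p? {xs = allFin k}) , λ i → ∈-filter⁺ p? (∈-allFin i)
  where
  p? : ∀ i → Dec (p i ≡ true)
  p? i = p i ≟ᵇ true

extendWith : ∀ {k} → (Fin k → Bool) → List (Fin k) → List (Fin k)
extendWith p L = elems (p ∖ L) ++ L

module _ {k} (p : Fin k → Bool) {L : List (Fin k)} where

  ∈-elems-∖⁻ : ∀ {x} → x ∈ elems (p ∖ L) → p x ≡ true × x ∉ L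
  ∈-elems-∖⁻ {x} = ∖-true⁻ p L ∘ proj₁ (proj₂ (elems-enumerates (p ∖ L))) x

  extendWith-unique : Unique L → Unique (extendWith p L)
  extendWith-unique unique = ++⁺ (proj₁ (elems-enumerates (p ∖ L))) unique
    λ (x∈new , x∈L) → proj₂ (∈-elems-∖⁻ x∈new) x∈L

  ∈-extendWith⁺ : ∀ {x} → p x ≡ true → x ∈ extendWith p L
  ∈-extendWith⁺ {x} px with x ∈ᵇ L in x∈ᵇL
  ... | true  = ∈-++⁺ʳ (elems (p ∖ L)) (∈ᵇ-true⁻ x∈ᵇL)
  ... | false = ∈-++⁺ˡ (proj₂ (proj₂ (elems-enumerates (p ∖ L))) x (∧-true px (cong not x∈ᵇL)))

  ∈-extendWith⁻ : ∀ {x} → x ∈ extendWith p L → (p x ≡ true × x ∉ L) ⊎ x ∈ L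
  ∈-extendWith⁻ {x} x∈ = map₁ ∈-elems-∖⁻ (∈-++⁻ (elems (p ∖ L)) x∈)

  length-extendWith : length (extendWith p L) ≡ count (p ∖ L) + length L
  length-extendWith = trans (length-++ (elems (p ∖ L))) (cong (_+ length L) (length-enumerates (elems-enumerates (p ∖ L))))

-- AtDepth L x d : x occurs in L followed by exactly d elements.  Depths do not change
-- when elements are prepended, which is how all lists below are built.
data AtDepth {A : Set} : List A → A → ℕ → Set where
  at-head : ∀ {x xs} → AtDepth (x ∷ xs) x (length xs)
  in-tail : ∀ {x y xs d} → AtDepth xs y d → AtDepth (x ∷ xs) y d

module _ {A : Set} where

  atDepth-∈ : ∀ {L : List A} {x d} → AtDepth L x d → x ∈ L
  atDepth-∈ at-head     = here refl
  atDepth-∈ (in-tail a) = there (atDepth-∈ a)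

  atDepth-< : ∀ {L : List A} {x d} → AtDepth L x d → d < length L
  atDepth-< at-head     = ≤-refl
  atDepth-< (in-tail a) = m≤n⇒m≤1+n (atDepth-< a)

  atDepth-++⁻ : ∀ (U : List A) {V x d} → AtDepth (U ++ V) x d →
                AtDepth V x d ⊎ ∃ λ d′ → AtDepth U x d′ × d ≡ d′ + length V
  atDepth-++⁻ []      a           = inj₁ a
  atDepth-++⁻ (u ∷ U) at-head     = inj₂ (length U , at-head , length-++ U)
  atDepth-++⁻ (u ∷ U) (in-tail a) with atDepth-++⁻ U a
  ... | inj₁ inV              = inj₁ inV
  ... | inj₂ (d′ , inU , d≡) = inj₂ (d′ , in-tail inU , d≡)

  lookup-atDepth : ∀ (L : List A) (p : Fin (length L)) →
                   ∃ λ d → AtDepth L (lookup L p) d × suc (toℕ p + d) ≡ length L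
  lookup-atDepth (x ∷ L) fzero    = length L , at-head , refl
  lookup-atDepth (x ∷ L) (fsuc p) with lookup-atDepth L p
  ... | d , a , eq = d , in-tail a , cong suc eq

module GraphFacts (G : Graph) where
  open Graph G

  IsMatching : (Fin m → Bool) → Set
  IsMatching S = ∀ e f → S e ≡ true → S f ≡ true → ¬ Adjacent G e f

  incident-end : ∀ v e → incident G v e ≡ true → v ≡ proj₁ (ends e) ⊎ v ≡ proj₂ (ends e)
  incident-end v e h with ∨-true⁻ h
  ... | inj₁ v≡u = inj₁ (==-true⁻ v≡u)
  ... | inj₂ v≡w = inj₂ (==-true⁻ v≡w)

  adjacent⇒≢ : ∀ e f → Adjacent G e f → e ≢ f
  adjacent⇒≢ e f h refl rewrite ==-refl e with () ← h

  adjacent⇒common-vertex : ∀ e f → Adjacent G e f → ∃ λ v → incident G v e ≡ true × incident G v f ≡ true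
  adjacent⇒common-vertex e f h with anyF-witness _ (∧-conicalʳ (not (e == f)) _ h)
  ... | v , both = v , ∧-conicalˡ _ _ both , ∧-conicalʳ _ _ both

  common-vertex⇒adjacent : ∀ v e f → e ≢ f → incident G v e ≡ true → incident G v f ≡ true → Adjacent G e f
  common-vertex⇒adjacent v e f e≢f ve vf rewrite dec-false (e ≟ f) e≢f =
    anyF-intro (λ u → incident G u e ∧ incident G u f) v (subst (λ b → b ∧ _ ≡ true) (sym ve) vf)

  adjacent-sym : ∀ e f → Adjacent G e f → Adjacent G f e
  adjacent-sym e f h with adjacent⇒common-vertex e f h
  ... | v , ve , vf = common-vertex⇒adjacent v f e (adjacent⇒≢ e f h ∘′ sym) vf ve

  matching-at-vertex : ∀ {S} → IsMatching S → ∀ v → count (λ f → S f ∧ incident G v f) ≤ 1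
  matching-at-vertex {S} matching v = count-atMostOne same
    where
    same : ∀ e f → (S e ∧ incident G v e) ≡ true → (S f ∧ incident G v f) ≡ true → e ≡ f
    same e f he hf with e ≟ f
    ... | yes e≡f = e≡f
    ... | no e≢f = ⊥-elim (matching e f (∧-conicalˡ _ _ he) (∧-conicalˡ _ _ hf)
                     (common-vertex⇒adjacent v e f e≢f (∧-conicalʳ _ _ he) (∧-conicalʳ _ _ hf)))

  matching-neighbours : ∀ {S} → IsMatching S → ∀ e → count (λ f → S f ∧ adjB G e f) ≤ 2
  matching-neighbours {S} matching e = ≤-trans (count-mono through-an-end)
    (≤-trans (count-∨ (λ f → S f ∧ incident G u f) (λ f → S f ∧ incident G w f))
             (+-mono-≤ (matching-at-vertex matching u) (matching-at-vertex matching w)))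
    where
    u w : Fin n
    u = proj₁ (ends e)
    w = proj₂ (ends e)
    through-an-end : ∀ f → (S f ∧ adjB G e f) ≡ true → ((S f ∧ incident G u f) ∨ (S f ∧ incident G w f)) ≡ true
    through-an-end f h with adjacent⇒common-vertex e f (∧-conicalʳ (S f) _ h)
    ... | v , ve , vf with incident-end v e ve
    ...   | inj₁ refl = ∨-true (inj₁ (∧-true Sf vf))
      where Sf = ∧-conicalˡ (S f) _ h
    ...   | inj₂ refl = ∨-true {S f ∧ incident G u f} (inj₂ (∧-true Sf vf))
      where Sf = ∧-conicalˡ (S f) _ h

module Greedy {k : ℕ} (adj : Fin k → Fin k → Bool) (Y Y′ Z : Fin k → Bool)
  (Y′⊆Y : ∀ r → Y′ r ≡ true → Y r ≡ true)
  (Y-degree : ∀ r → Y r ≡ true → count (λ z → Z z ∧ adj r z) ≤ 2)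
  (Y′-degree : ∀ r → Y′ r ≡ true → count (λ z → Z z ∧ adj r z) ≤ 1)
  (Z-degree : ∀ z → Z z ≡ true → count (λ r → Y r ∧ adj r z) ≤ 2)
  (|Y|≤|Z| : count Y ≤ count Z) where

  a b : ℕ
  a = count Y
  b = count Z

  -- In A ++ B with |A| = a, |B| = b, the edge r at depth dr in A precedes the edge z at
  -- depth dz in B by b + dr − dz positions; this asks for at least a − 1.
  WellSpread : List (Fin k) → List (Fin k) → Set
  WellSpread A B = ∀ {r z dr dz} → AtDepth A r dr → AtDepth B z dz → adj r z ≡ true → dz + a ≤ suc (dr + b)

  record Placement : Set where
    field
      A B         : List (Fin k)
      A-unique    : Unique A
      B-unique    : Unique B
      A⊆Y         : ∀ r → r ∈ A → Y r ≡ true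
      B⊆Z         : ∀ z → z ∈ B → Z z ≡ true
      closed      : ∀ r z → r ∈ A → Z z ≡ true → adj r z ≡ true → z ∈ B
      well-spread : WellSpread A B
      slack       : length B + a ≤ suc (length A + b)
  open Placement

  empty : Placement
  empty = record
    { A = [] ; B = [] ; A-unique = [] ; B-unique = []
    ; A⊆Y = λ _ () ; B⊆Z = λ _ () ; closed = λ _ _ () ; well-spread = λ ()
    ; slack = m≤n⇒m≤1+n |Y|≤|Z| }

  neighbours : Fin k → Fin k → Bool
  neighbours r z = Z z ∧ adj r z

  -- The slack invariant after placing r.
  Admissible : Placement → Fin k → Set
  Admissible P r = count (neighbours r ∖ B P) + length (B P) + a ≤ suc (suc (length (A P) + b))

  place : (P : Placement) (r : Fin k) → Y r ≡ true → r ∉ A P → Admissible P r → Placement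
  place P r Yr r∉A admissible = record
    { A = r ∷ A P
    ; B = extendWith (neighbours r) (B P)
    ; A-unique = ¬Any⇒All¬ (A P) r∉A ∷ A-unique P
    ; B-unique = extendWith-unique (neighbours r) (B-unique P)
    ; A⊆Y = λ { _ (here refl) → Yr ; r′ (there r′∈A) → A⊆Y P r′ r′∈A }
    ; B⊆Z = B⊆Z′
    ; closed = closed′
    ; well-spread = well-spread′
    ; slack = subst (λ n → n + a ≤ _) (sym (length-extendWith (neighbours r))) admissible
    }
    where
    B⊆Z′ : ∀ z → z ∈ extendWith (neighbours r) (B P) → Z z ≡ true
    B⊆Z′ z z∈ with ∈-extendWith⁻ (neighbours r) z∈
    ... | inj₁ (nz , _) = ∧-conicalˡ (Z z) _ nz
    ... | inj₂ z∈B      = B⊆Z P z z∈B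

    closed′ : ∀ r′ z → r′ ∈ r ∷ A P → Z z ≡ true → adj r′ z ≡ true → z ∈ extendWith (neighbours r) (B P)
    closed′ _ z (here refl)   Zz adj-rz = ∈-extendWith⁺ (neighbours r) (∧-true Zz adj-rz)
    closed′ r′ z (there r′∈A) Zz adj-rz = ∈-++⁺ʳ _ (closed P r′ z r′∈A Zz adj-rz)

    well-spread′ : WellSpread (r ∷ A P) (extendWith (neighbours r) (B P))
    well-spread′ ar az adj-rz with ar | atDepth-++⁻ (elems (neighbours r ∖ B P)) az
    ... | at-head    | inj₁ inB = ≤-trans (+-monoˡ-≤ a (<⇒≤ (atDepth-< inB))) (slack P)
    ... | at-head    | inj₂ (d , inNew , refl) = ≤-pred (≤-trans
          (+-monoˡ-≤ a (+-monoˡ-≤ (length (B P)) (subst (d <_) (length-enumerates (elems-enumerates (neighbours r ∖ B P))) (atDepth-< inNew))))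
          admissible)
    ... | in-tail ar | inj₁ inB = well-spread P ar inB adj-rz
    ... | in-tail ar | inj₂ (_ , inNew , _) with ∈-elems-∖⁻ (neighbours r) (atDepth-∈ inNew)
    ...   | nz , z∉B = ⊥-elim (z∉B (closed P _ _ (atDepth-∈ ar) (∧-conicalˡ (Z _) _ nz) adj-rz))

  record Extension (S : Fin k → Bool) (P : Placement) : Set where
    field
      final     : Placement
      added     : List (Fin k)
      A-final   : A final ≡ added ++ A P
      added-new : ∀ u → u ∈ added → S u ≡ true × u ∉ A P
      covers    : ∀ r → S r ≡ true → r ∈ A final

  Chooser : (Fin k → Bool) → Set
  Chooser S = ∀ P → 0 < count (S ∖ A P) → ∃ λ r → (S ∖ A P) r ≡ true × Admissible P r

  extend : ∀ {S} → (∀ r → S r ≡ true → Y r ≡ true) → Chooser S → ∀ P → Extension S P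
  extend {S} S⊆Y choose P = go _ P refl
    where
    go : ∀ n P → count (S ∖ A P) ≡ n → Extension S P
    go zero P none = record
      { final = P ; added = [] ; A-final = refl ; added-new = λ _ () ; covers = placed }
      where
      placed : ∀ r → S r ≡ true → r ∈ A P
      placed r Sr with r ∈ᵇ A P in r∈ᵇA
      ... | true  = ∈ᵇ-true⁻ r∈ᵇA
      ... | false = ⊥-elim (<-irrefl (sym none) (count-pos r (∧-true Sr (cong not r∈ᵇA))))
    go (suc n) P count≡ with choose P (subst (0 <_) (sym count≡) (s≤s z≤n))
    ... | r , r-remains , admissible = prepend (go n P′ (suc-injective (trans (sym fewer) count≡)))
      where
      r∉A : r ∉ A P
      r∉A = proj₂ (∖-true⁻ S (A P) r-remains)
      P′ : Placement
      P′ = place P r (S⊆Y r (proj₁ (∖-true⁻ S (A P) r-remains))) r∉A admissible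

      fewer : count (S ∖ A P) ≡ suc (count (S ∖ A P′))
      fewer = count-∖-∷ S (A P) r-remains

      prepend : Extension S P′ → Extension S P
      prepend E = record
        { final = final
        ; added = added ++ [ r ]
        ; A-final = trans A-final (sym (++-assoc added [ r ] (A P)))
        ; added-new = added-new′
        ; covers = covers
        }
        where
        open Extension E
        added-new′ : ∀ u → u ∈ added ++ [ r ] → S u ≡ true × u ∉ A P
        added-new′ u u∈ with ∈-++⁻ added u∈
        ... | inj₁ u∈added with added-new u u∈added
        ...   | Su , u∉rA = Su , u∉rA ∘ there
        added-new′ u u∈ | inj₂ (here refl) = ∖-true⁻ S (A P) r-remains

  admissible-when-one-new : ∀ P r → count (neighbours r ∖ B P) ≤ 1 → Admissible P r
  admissible-when-one-new P r one = ≤-trans (+-monoˡ-≤ a (+-monoˡ-≤ (length (B P)) one)) (s≤s (slack P))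

  admissible-when-tight : ∀ P r → count (neighbours r ∖ B P) ≤ 2 →
                          length (B P) + a ≤ length (A P) + b → Admissible P r
  admissible-when-tight P r two tight = ≤-trans (+-monoˡ-≤ a (+-monoˡ-≤ (length (B P)) two)) (s≤s (s≤s tight))

  new-neighbours≤ : ∀ P r → count (neighbours r ∖ B P) ≤ count (neighbours r)
  new-neighbours≤ P r = count-mono λ z h → proj₁ (∖-true⁻ (neighbours r) (B P) {z} h)

  tight-when-crowded : ∀ P → (∀ r → (Y ∖ A P) r ≡ true → 2 ≤ count (neighbours r ∖ B P)) →
                       length (B P) + a ≤ length (A P) + b
  tight-when-crowded P crowded = begin
    length (B P) + a                          ≡⟨ cong (length (B P) +_) (count-outside Y (A-unique P) (A⊆Y P)) ⟩
    length (B P) + (length (A P) + count R)  ≤⟨ +-monoʳ-≤ (length (B P)) (+-monoʳ-≤ (length (A P)) R≤F) ⟩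
    length (B P) + (length (A P) + count F)  ≡⟨ x∙yz≈y∙xz (length (B P)) (length (A P)) (count F) ⟩
    length (A P) + (length (B P) + count F)  ≡⟨ cong (length (A P) +_) (count-outside Z (B-unique P) (B⊆Z P)) ⟨
    length (A P) + b                          ∎
    where
    open ≤-Reasoning
    R F : Fin k → Bool
    R = Y ∖ A P
    F = Z ∖ B P
    E : Fin k → Fin k → Bool
    E r z = R r ∧ (neighbours r ∖ B P) z
    R≤F : count R ≤ count F
    R≤F = *-cancelˡ-≤ 2 (double-count 2 R F E out-degree in-degree E⊆F)
      where
      out-degree : ∀ r → R r ≡ true → 2 ≤ count (E r)
      out-degree r Rr = subst (2 ≤_) (count-cong λ z → cong (_∧ (neighbours r ∖ B P) z) (sym Rr)) (crowded r Rr)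
      in-degree : ∀ z → F z ≡ true → count (λ r → E r z) ≤ 2
      in-degree z Fz = ≤-trans (count-mono E⊆Y-neighbours) (Z-degree z (proj₁ (∖-true⁻ Z (B P) Fz)))
        where
        E⊆Y-neighbours : ∀ r → E r z ≡ true → (Y r ∧ adj r z) ≡ true
        E⊆Y-neighbours r Erz = ∧-true (proj₁ (∖-true⁻ Y (A P) (∧-conicalˡ (R r) _ Erz)))
          (∧-conicalʳ (Z z) _ (proj₁ (∖-true⁻ (neighbours r) (B P) (∧-conicalʳ (R r) _ Erz))))
      E⊆F : ∀ r z → E r z ≡ true → F z ≡ true
      E⊆F r z Erz with ∖-true⁻ (neighbours r) (B P) (∧-conicalʳ (R r) _ Erz)
      ... | nz , z∉B = ∖-true {p = Z} {L = B P} (∧-conicalˡ (Z z) _ nz) z∉B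

  choose-Y′ : Chooser Y′
  choose-Y′ P pos with count-witness _ pos
  ... | r , r-remains = r , r-remains , admissible-when-one-new P r
        (≤-trans (new-neighbours≤ P r) (Y′-degree r (proj₁ (∖-true⁻ Y′ (A P) r-remains))))

  choose-Y : Chooser Y
  choose-Y P pos with any? (λ r → ((Y ∖ A P) r ≟ᵇ true) ×-dec (count (neighbours r ∖ B P) ≤? 1))
  ... | yes (r , r-remains , one) = r , r-remains , admissible-when-one-new P r one
  ... | no none with count-witness _ pos
  ...   | r , r-remains = r , r-remains , admissible-when-tight P r
          (≤-trans (new-neighbours≤ P r) (Y-degree r (proj₁ (∖-true⁻ Y (A P) r-remains))))
          (tight-when-crowded P λ r′ r′-remains → ≰⇒> λ one → none (r′ , r′-remains , one))

  complete : (P : Placement) → ∃ λ B′ → Enumerates Z B′ × WellSpread (A P) B′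
  complete P = extendWith Z (B P) , (extendWith-unique Z (B-unique P) , ⊆Z , λ z → ∈-extendWith⁺ Z) , well-spread′
    where
    ⊆Z : ∀ z → z ∈ extendWith Z (B P) → Z z ≡ true
    ⊆Z z z∈ with ∈-extendWith⁻ Z z∈
    ... | inj₁ (Zz , _) = Zz
    ... | inj₂ z∈B      = B⊆Z P z z∈B

    well-spread′ : WellSpread (A P) (extendWith Z (B P))
    well-spread′ ar az adj-rz with atDepth-++⁻ (elems (Z ∖ B P)) az
    ... | inj₁ inB = well-spread P ar inB adj-rz
    ... | inj₂ (_ , inNew , _) with ∈-elems-∖⁻ Z (atDepth-∈ inNew)
    ...   | Zz , z∉B = ⊥-elim (z∉B (closed P _ _ (atDepth-∈ ar) Zz adj-rz))

  record SpreadOrdering : Set where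
    field
      A B U V     : List (Fin k)
      A-enum      : Enumerates Y A
      B-enum      : Enumerates Z B
      A≡U++V      : A ≡ U ++ V
      V⊆Y′        : ∀ v → v ∈ V → Y′ v ≡ true
      U∩Y′≡∅      : ∀ u → u ∈ U → Y′ u ≡ false
      well-spread : WellSpread A B

  spread-ordering : SpreadOrdering
  spread-ordering = record
    { A = A P ; B = proj₁ completion ; U = E₂.added ; V = A E₁.final
    ; A-enum = A-unique P , A⊆Y P , E₂.covers
    ; B-enum = proj₁ (proj₂ completion)
    ; A≡U++V = E₂.A-final
    ; V⊆Y′ = V⊆Y′
    ; U∩Y′≡∅ = U∩Y′≡∅
    ; well-spread = proj₂ (proj₂ completion)
    }
    where
    -- The edges of Y′ are placed first, so they end up at the back of A.
    module E₁ = Extension (extend Y′⊆Y choose-Y′ empty)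
    module E₂ = Extension (extend (λ _ Yr → Yr) choose-Y E₁.final)
    P : Placement
    P = E₂.final
    completion : ∃ λ B′ → Enumerates Z B′ × WellSpread (A P) B′
    completion = complete P

    V⊆Y′ : ∀ v → v ∈ A E₁.final → Y′ v ≡ true
    V⊆Y′ v v∈ = proj₁ (E₁.added-new v (subst (v ∈_) (trans E₁.A-final (++-identityʳ E₁.added)) v∈))

    U∩Y′≡∅ : ∀ u → u ∈ E₂.added → Y′ u ≡ false
    U∩Y′≡∅ u u∈ with Y′ u in Y′u
    ... | true  = ⊥-elim (proj₂ (E₂.added-new u u∈) (E₁.covers u Y′u))
    ... | false = refl

mod-small : ∀ {a n} → a < n → a mod n ≡ a
mod-small {n = suc n} a<n = m<n⇒m%n≡m a<n

earlier-is-deeper : ∀ {p q dp dq} → p + dp ≡ q + dq → dp < dq → q < p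
earlier-is-deeper {p} {q} {dp} {dq} eq dp<dq with q <? p
... | yes q<p = q<p
... | no q≮p  = ⊥-elim (<-irrefl eq (+-mono-≤-< (≮⇒≥ q≮p) dp<dq))

gap-from-depths : ∀ {p q dA dB a b} → p < q → p + (dA + b) ≡ q + dB → dB + a ≤ suc (dA + b) →
                  p + suc (a ∸ 2) ≤ q
gap-from-depths {p} {q} {a = zero}     p<q _ _ = subst (_≤ q) (+-comm 1 p) p<q
gap-from-depths {p} {q} {a = suc zero} p<q _ _ = subst (_≤ q) (+-comm 1 p) p<q
gap-from-depths {p} {q} {dA} {dB} {suc (suc a)} {b} _ eq spread = +-cancelʳ-≤ dB (p + suc a) q (begin
  p + suc a + dB    ≡⟨ trans (+-assoc p (suc a) dB) (cong (p +_) (+-comm (suc a) dB)) ⟩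
  p + (dB + suc a)  ≤⟨ +-monoʳ-≤ p (≤-pred (subst (_≤ suc (dA + b)) (+-suc dB (suc a)) spread)) ⟩
  p + (dA + b)      ≡⟨ eq ⟩
  q + dB            ∎)
  where open ≤-Reasoning

module _ (G : Graph) where
  open Graph G
  open Orderings G

  spreadAtLeast-from-gaps : ∀ L s → (∀ p q → toℕ p < toℕ q → Adjacent G (lookup L p) (lookup L q) → toℕ p + s ≤ toℕ q) →
                            SpreadAtLeast L s
  spreadAtLeast-from-gaps L s gaps p q p<q adj d _ d<s p+d≡q =
    <-irrefl (trans (sym (mod-small (<-trans p+d<q (toℕ<n q)))) p+d≡q) p+d<q
    where
    p+d<q : toℕ p + d < toℕ q
    p+d<q = <-≤-trans (+-monoʳ-< (toℕ p) d<s) (gaps p q p<q adj)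

  msAtLeast-++ : ∀ (A B : List (Fin m)) {a b} → length A ≡ a → length B ≡ b → 0 < a + b →
                 (∀ e f → e ∈ A → f ∈ A → ¬ Adjacent G e f) →
                 (∀ e f → e ∈ B → f ∈ B → ¬ Adjacent G e f) →
                 (∀ {r z dr dz} → AtDepth A r dr → AtDepth B z dz → Adjacent G r z → dz + a ≤ suc (dr + b)) →
                 MsAtLeast (A ++ B) (a ∸ 1)
  msAtLeast-++ A B {a} {b} refl refl nonempty A-indep B-indep spread =
    suc (a ∸ 2) , s≤s z≤n , fits , a∸1≤ a , spreadAtLeast-from-gaps (A ++ B) _ gaps
    where
    fits : suc (a ∸ 2) ≤ length (A ++ B)
    fits rewrite length-++ A {B} with a
    ... | zero  = nonempty
    ... | suc a′ = s≤s (≤-trans (m∸n≤m a′ 1) (m≤m+n a′ b))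
    a∸1≤ : ∀ a → a ∸ 1 ≤ suc (a ∸ 2)
    a∸1≤ zero          = z≤n
    a∸1≤ (suc zero)    = z≤n
    a∸1≤ (suc (suc a)) = ≤-refl
    gaps : ∀ p q → toℕ p < toℕ q → Adjacent G (lookup (A ++ B) p) (lookup (A ++ B) q) → toℕ p + suc (a ∸ 2) ≤ toℕ q
    gaps p q p<q adj with lookup-atDepth (A ++ B) p | lookup-atDepth (A ++ B) q
    ... | dp , atP , lenP | dq , atQ , lenQ with atDepth-++⁻ A atP | atDepth-++⁻ A atQ
    ...   | inj₁ inBp | inj₁ inBq = ⊥-elim (B-indep _ _ (atDepth-∈ inBp) (atDepth-∈ inBq) adj)
    ...   | inj₂ (_ , inAp , _) | inj₂ (_ , inAq , _) = ⊥-elim (A-indep _ _ (atDepth-∈ inAp) (atDepth-∈ inAq) adj)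
    ...   | inj₁ inBp | inj₂ (dA , _ , refl) = ⊥-elim (<⇒≱ p<q (<⇒≤ (earlier-is-deeper
            (suc-injective (trans lenP (sym lenQ))) (≤-trans (atDepth-< inBp) (m≤n+m (length B) dA)))))
    ...   | inj₂ (dA , inAp , refl) | inj₁ inBq =
            gap-from-depths {dA = dA} p<q (suc-injective (trans lenP (sym lenQ))) (spread inAp inBq adj)

  lastOccur-++ : ∀ (S : Fin m → Bool) U V → (∀ v → v ∈ V → S v ≡ true) → (∀ u → u ∈ U → S u ≡ false) →
                 LastOccur S (U ++ V)
  lastOccur-++ S U V V⊆S U∩S≡∅ p q Sp Sq with lookup-atDepth (U ++ V) p | lookup-atDepth (U ++ V) q
  ... | dp , atP , lenP | dq , atQ , lenQ with atDepth-++⁻ U atP | atDepth-++⁻ U atQ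
  ...   | inj₂ (_ , inUp , _) | _ = ⊥-elim (true≢false Sp (U∩S≡∅ _ (atDepth-∈ inUp)))
  ...   | inj₁ inVp | inj₁ inVq = ⊥-elim (true≢false (V⊆S _ (atDepth-∈ inVq)) Sq)
  ...   | inj₁ inVp | inj₂ (dU , _ , refl) = earlier-is-deeper (suc-injective (trans lenP (sym lenQ)))
          (≤-trans (atDepth-< inVp) (m≤n+m (length V) dU))

%-absorbˡ-+ : ∀ a k n .{{_ : NonZero n}} → (a % n + k) % n ≡ (a + k) % n
%-absorbˡ-+ a k n = begin
  (a % n + k) % n          ≡⟨ %-distribˡ-+ (a % n) k n ⟩
  (a % n % n + k % n) % n  ≡⟨ cong (λ t → (t + k % n) % n) (m%n%n≡m%n a n) ⟩
  (a % n + k % n) % n      ≡⟨ %-distribˡ-+ a k n ⟨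
  (a + k) % n              ∎
  where open ≡-Reasoning

[m+n]%n≡m : ∀ {m n} .{{_ : NonZero n}} → m < n → (m + n) % n ≡ m
[m+n]%n≡m {m} {n} m<n = trans ([m+n]%n≡m%n m n) (m<n⇒m%n≡m m<n)

prev-next : ∀ {c} (i : Fin c) → prev (next i) ≡ i
prev-next {suc k} i = toℕ-injective (begin
  toℕ (prev (next i))                 ≡⟨ toℕ-fromℕ< (m%n<n (toℕ (next i) + k) (suc k)) ⟩
  (toℕ (next i) + k) % suc k          ≡⟨ cong (λ t → (t + k) % suc k) (toℕ-fromℕ< (m%n<n (suc (toℕ i)) (suc k))) ⟩
  (suc (toℕ i) % suc k + k) % suc k   ≡⟨ %-absorbˡ-+ (suc (toℕ i)) k (suc k) ⟩
  (suc (toℕ i) + k) % suc k           ≡⟨ cong (_% suc k) (sym (+-suc (toℕ i) k)) ⟩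
  (toℕ i + suc k) % suc k             ≡⟨ [m+n]%n≡m (toℕ<n i) ⟩
  toℕ i                               ∎)
  where open ≡-Reasoning

next-prev : ∀ {c} (i : Fin c) → next (prev i) ≡ i
next-prev {suc k} i = toℕ-injective (begin
  toℕ (next (prev i))                 ≡⟨ toℕ-fromℕ< (m%n<n (suc (toℕ (prev i))) (suc k)) ⟩
  suc (toℕ (prev i)) % suc k          ≡⟨ cong (λ t → suc t % suc k) (toℕ-fromℕ< (m%n<n (toℕ i + k) (suc k))) ⟩
  suc ((toℕ i + k) % suc k) % suc k   ≡⟨ cong (_% suc k) (+-comm 1 _) ⟩
  ((toℕ i + k) % suc k + 1) % suc k   ≡⟨ %-absorbˡ-+ (toℕ i + k) 1 (suc k) ⟩
  (toℕ i + k + 1) % suc k             ≡⟨ cong (_% suc k) (trans (+-assoc (toℕ i) k 1) (cong (toℕ i +_) (+-comm k 1))) ⟩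
  (toℕ i + suc k) % suc k             ≡⟨ [m+n]%n≡m (toℕ<n i) ⟩
  toℕ i                               ∎)
  where open ≡-Reasoning

yOf≡0⇒x≡0 : ∀ x w → 2 * w ≤ 3 * x → yOf x w ≡ 0 → x ≡ 0
yOf≡0⇒x≡0 x w 2w≤3x y≡0 = n≤0⇒n≡0 (+-cancelʳ-≤ (3 * x) x 0 (begin
  x + 3 * x      ≡⟨ *-assoc 2 2 x ⟩
  2 * (2 * x)    ≤⟨ *-monoʳ-≤ 2 2x≤w ⟩
  2 * w          ≤⟨ 2w≤3x ⟩
  3 * x          ∎))
  where
  open ≤-Reasoning
  6x≤3w : 6 * x ≤ 3 * w
  6x≤3w = m∸n≡0⇒m≤n (n<1⇒n≡0 (+-cancelʳ-< 1 (6 * x ∸ 3 * w) 1 (m/n≡0⇒m<n y≡0)))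
  2x≤w : 2 * x ≤ w
  2x≤w = *-cancelˡ-≤ 3 (subst (_≤ 3 * w) (*-assoc 3 2 x) 6x≤3w)

module PartitionOrderings (G : Graph) (c : ℕ) (χ : ChromaticIndex G c) (x w : ℕ)
  (cls : Fin (Graph.m G) → Fin c) (rl : Fin (Graph.m G) → Role)
  (P : Partition.IsXWPartition G cls rl x w) where
  open Graph G
  open Partition G cls rl
  open IsXWPartition P
  open GraphFacts G
  open Orderings G

  y : ℕ
  y = yOf x w

  matching-in-part : ∀ i {S} → (∀ e → S e ≡ true → inH i e ≡ true) → IsMatching S
  matching-in-part i S⊆Hᵢ e f Se Sf = P2-matching e f (trans (==-true⁻ (S⊆Hᵢ e Se)) (sym (==-true⁻ (S⊆Hᵢ f Sf))))

  c≤m : c ≤ m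
  c≤m = proj₂ χ m ((λ e → e) , adjacent⇒≢)

  |H|≤x+y+|Z| : ∀ j → count (inH j) ≤ x + y + count (inZ j)
  |H|≤x+y+|Z| j = begin
    count (inH j)                                          ≤⟨ count-mono by-role ⟩
    count (λ e → (inX j e ∨ inY j e) ∨ inZ j e)            ≤⟨ count-∨ _ (inZ j) ⟩
    count (λ e → inX j e ∨ inY j e) + count (inZ j)        ≤⟨ +-monoˡ-≤ _ (count-∨ (inX j) (inY j)) ⟩
    count (inX j) + count (inY j) + count (inZ j)          ≡⟨ cong₂ (λ p q → p + q + count (inZ j)) (P3-X j) (P3-Y j) ⟩
    x + y + count (inZ j)                                  ∎
    where
    open ≤-Reasoning
    by-role : ∀ e → inH j e ≡ true → ((inX j e ∨ inY j e) ∨ inZ j e) ≡ true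
    by-role e Hje rewrite Hje with rl e
    ... | RX = refl
    ... | RY = refl
    ... | RZ = refl

  y≤|Z| : ∀ j → y ≤ count (inZ j)
  y≤|Z| j = +-cancelˡ-≤ y y _ (+-cancelˡ-≤ x (y + y) _ (begin
    x + (y + y)                ≡⟨ cong (λ t → x + (y + t)) (sym (+-identityʳ y)) ⟩
    x + 2 * y                  ≤⟨ P1b ⟩
    floorDiv m c               ≤⟨ floorDiv≤part cls P2-equitable j ⟩
    count (inH j)              ≤⟨ |H|≤x+y+|Z| j ⟩
    x + y + count (inZ j)      ≡⟨ +-assoc x y _ ⟩
    x + (y + count (inZ j))    ∎))
    where open ≤-Reasoning

  nonempty : ∀ i → 0 < count (inY i) + count (inZ (next i))
  nonempty i rewrite P3-Y i with yOf x w in y≡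
  ... | suc _ = s≤s z≤n
  ... | zero  = ≤-trans (floorDiv-pos i c≤m) (≤-trans (floorDiv≤part cls P2-equitable (next i))
                  (≤-trans (|H|≤x+y+|Z| (next i)) (≤-reflexive (cong₂ (λ p q → p + q + count (inZ (next i))) x≡0 y≡))))
    where x≡0 = yOf≡0⇒x≡0 x w P1a y≡

  record Consecutive (i : Fin c) : Set where
    field
      ℓY ℓZ      : List (Fin m)
      Y-ordering : IsOrdering (inY i) ℓY
      Z-ordering : IsOrdering (inZ (next i)) ℓZ
      ms         : MsAtLeast (ℓY ++ ℓZ) (y ∸ 1)
      Y′-last    : LastOccur (inY' i) ℓY

  consecutive : ∀ i → Consecutive i
  consecutive i = record
    { ℓY = A ; ℓZ = B ; Y-ordering = A-enum ; Z-ordering = B-enum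
    ; ms = subst (λ t → MsAtLeast (A ++ B) (t ∸ 1)) (P3-Y i)
        (msAtLeast-++ G A B (length-enumerates A-enum) (length-enumerates B-enum) (nonempty i)
          (λ e f e∈ f∈ → Yᵢ-matching e f (proj₁ (proj₂ A-enum) e e∈) (proj₁ (proj₂ A-enum) f f∈))
          (λ e f e∈ f∈ → Zⱼ-matching e f (proj₁ (proj₂ B-enum) e e∈) (proj₁ (proj₂ B-enum) f f∈))
          well-spread)
    ; Y′-last = subst (LastOccur (inY' i)) (sym A≡U++V) (lastOccur-++ G (inY' i) U V V⊆Y′ U∩Y′≡∅)
    }
    where
    j : Fin c
    j = next i
    Yᵢ-matching : IsMatching (inY i)
    Yᵢ-matching = matching-in-part i λ e → ∧-conicalˡ _ _
    Zⱼ-matching : IsMatching (inZ j)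
    Zⱼ-matching = matching-in-part j λ e → ∧-conicalˡ _ _

    Z-degree : ∀ z → inZ j z ≡ true → count (λ r → inY i r ∧ adjB G r z) ≤ 2
    Z-degree z _ = ≤-trans (count-mono λ r h → ∧-true (∧-conicalˡ (inY i r) _ h) (adjacent-sym r z (∧-conicalʳ (inY i r) _ h)))
                           (matching-neighbours Yᵢ-matching z)

    open Greedy (adjB G) (inY i) (inY' i) (inZ j) (λ r → ∧-conicalˡ (inY i r) _)
      (λ r _ → matching-neighbours Zⱼ-matching r) (P5-adj i) Z-degree
      (subst (_≤ count (inZ j)) (sym (P3-Y i)) (y≤|Z| j))
    open SpreadOrdering spread-ordering

lemma5p1 : (G : Graph) (c : ℕ) → ChromaticIndex G c →
    (x w : ℕ) (cls : Fin (Graph.m G) → Fin c) (rl : Fin (Graph.m G) → Role) →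
    Partition.IsXWPartition G cls rl x w →
    Σ (Fin c → List (Fin (Graph.m G))) λ ℓY →
    Σ (Fin c → List (Fin (Graph.m G))) λ ℓZ →
      ∀ (i : Fin c) →
        Orderings.IsOrdering G (Partition.inY G cls rl i) (ℓY i)
        × Orderings.IsOrdering G (Partition.inZ G cls rl i) (ℓZ i)
        × Orderings.MsAtLeast G (ℓY i ++ ℓZ (next i)) (yOf x w ∸ 1)
        × Orderings.LastOccur G (Partition.inY' G cls rl i) (ℓY i)
lemma5p1 G c χ x w cls rl P = ℓY , ℓZ , λ i →
    Y-ordering (consecutive i)
  , subst (λ j → IsOrdering (inZ j) (ℓZ i)) (next-prev i) (Z-ordering (consecutive (prev i)))
  , subst (λ j → MsAtLeast (ℓY i ++ Consecutive.ℓZ (consecutive j)) (yOf x w ∸ 1)) (sym (prev-next i)) (ms (consecutive i))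
  , Y′-last (consecutive i)
  where
  open Partition G cls rl
  open Orderings G
  open PartitionOrderings G c χ x w cls rl P
  open Consecutive using (Y-ordering; Z-ordering; ms; Y′-last)
  ℓY : Fin c → List (Fin (Graph.m G))
  ℓY i = Consecutive.ℓY (consecutive i)
  ℓZ : Fin c → List (Fin (Graph.m G))
  ℓZ j = Consecutive.ℓZ (consecutive (prev j))
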